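{- For every two positive integers $L_1$ and $L_2$ with $1 < L_1 < L_2$, there exists a disconnected graph $G$ such that $\chi^{\mathrm{FAT}}(G) = L_1$ and $\chi(G) = L_2$.
   Context: All graphs are simple with a finite nonempty vertex set. $\chi(G)$ denotes the chromatic number of $G$. For a vertex $v$ and a set $S\subseteq V(G)$, let $e(v,S)=|S\cap N(v)|$, where $N(v)$ is the set of neighbors of $v$ and $\deg(v)=|N(v)|$. A (not necessarily proper) vertex coloring of $G$ with color classes $V_1,\dots,V_k$ is a Fair And Tolerant (FAT) $k$-coloring if $V_1,\dots,V_k$ are all nonempty, they partition $V(G)$, and there exist real numbers $\alpha,\beta\in[0,1]$ such that for every vertex $v$ and every $i\in\{1,\dots,k\}$: $e(v,V_i)=\alpha\deg(v)$ if $v\notin V_i$, and $e(v,V_i)=\beta\deg(v)$ if $v\in V_i$. The FAT chromatic number $\chi^{\mathrm{FAT}}(G)$ is the maximum $k$ such that $G$ admits a FAT $k$-coloring (a FAT $1$-coloring always exists).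
   Formalization: The parameters α and β of a FAT coloring are taken in the rationals in [0,1] rather than the real numbers in [0,1]. -}

module Defs where

open import Data.Nat using (ℕ; zero; suc; _+_; _≤_; _<_)
open import Data.Fin using (Fin; zero; suc)
open import Data.Bool using (Bool; true; false; _∧_)
open import Data.Product using (Σ; ∃; _×_; _,_)
open import Data.Integer using (+_)
open import Data.Rational using (ℚ; _/_; _*_; 0ℚ; 1ℚ)
import Data.Rational as ℚ
open import Relation.Binary.PropositionalEquality using (_≡_; _≢_)
open import Relation.Nullary using (¬_; does)
open import Data.Fin using (_≟_)

record Graph : Set where
  field
    order    : ℕ
    nonempty : 0 < order
    adj      : Fin order → Fin order → Bool
    adj-sym  : ∀ u v → adj u v ≡ adj v u
    irrefl   : ∀ v → adj v v ≡ false

open Graph public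

b2n : Bool → ℕ
b2n true  = 1
b2n false = 0

count : ∀ {n} → (Fin n → Bool) → ℕ
count {zero}  p = 0
count {suc n} p = b2n (p zero) + count (λ i → p (suc i))

Vertex : Graph → Set
Vertex G = Fin (order G)

deg : (G : Graph) → Vertex G → ℕ
deg G v = count (adj G v)

eColor : (G : Graph) {k : ℕ} → (Vertex G → Fin k) → Vertex G → Fin k → ℕ
eColor G c v i = count (λ u → adj G v u ∧ does (c u ≟ i))

ℕ→ℚ : ℕ → ℚ
ℕ→ℚ n = + n / 1

-- a (not necessarily proper) coloring with classes V_1..V_k given by c
-- (V_i = c⁻¹(i)); all classes nonempty = c surjective.
IsFATColoring : (G : Graph) (k : ℕ) → (Vertex G → Fin k) → Set
IsFATColoring G k c =
  (∀ (i : Fin k) → ∃ λ v → c v ≡ i) ×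
  Σ ℚ λ α → Σ ℚ λ β →
    (0ℚ ℚ.≤ α) × (α ℚ.≤ 1ℚ) × (0ℚ ℚ.≤ β) × (β ℚ.≤ 1ℚ) ×
    (∀ (v : Vertex G) (i : Fin k) →
       (c v ≢ i → ℕ→ℚ (eColor G c v i) ≡ α * ℕ→ℚ (deg G v)) ×
       (c v ≡ i → ℕ→ℚ (eColor G c v i) ≡ β * ℕ→ℚ (deg G v)))

HasFATColoring : Graph → ℕ → Set
HasFATColoring G k = ∃ λ (c : Vertex G → Fin k) → IsFATColoring G k c

IsFATChromaticNumber : Graph → ℕ → Set
IsFATChromaticNumber G k = HasFATColoring G k × (∀ j → HasFATColoring G j → j ≤ k)

IsProperColoring : (G : Graph) (k : ℕ) → (Vertex G → Fin k) → Set
IsProperColoring G k c = ∀ u v → adj G u v ≡ true → c u ≢ c v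

HasProperColoring : Graph → ℕ → Set
HasProperColoring G k = ∃ λ (c : Vertex G → Fin k) → IsProperColoring G k c

IsChromaticNumber : Graph → ℕ → Set
IsChromaticNumber G k = HasProperColoring G k × (∀ j → HasProperColoring G j → k ≤ j)

data Reachable (G : Graph) : Vertex G → Vertex G → Set where
  here : ∀ {v} → Reachable G v v
  step : ∀ {u w v} → adj G u w ≡ true → Reachable G w v → Reachable G u v

Disconnected : Graph → Set
Disconnected G = ∃ λ (u : Vertex G) → ∃ λ (v : Vertex G) → ¬ Reachable G u v

-- The witness is K₂ ⊎ m·K₁ ⊎ K_{L₂} with L₁ = m + 2 components.  Colouring
-- each component with its own colour is FAT (α = 0, β = 1).  Conversely,
-- an endpoint a of the K₂ has the single neighbour b, so a FAT colouring
-- with a colour other than those of a and b has e(a, Vᵢ) = 0 = α·1; then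
-- α = 0 forces every edge to be monochromatic, so the colour classes are
-- unions of components and there are at most L₁ of them.  The chromatic
-- number is that of the largest clique.
module Submission where

open import Defs
open import Data.Nat using (ℕ; zero; suc; _+_; _≤_; _<_; z≤n; s≤s)
open import Data.Nat.Properties using (≤-trans; m+n≡0⇒n≡0; *-identityʳ)
open import Data.Fin using (Fin; zero; suc; _≟_; splitAt; join; _↑ˡ_; _↑ʳ_)
open import Data.Fin.Properties
  using ( injective⇒≤; any?; suc-injective; 0≢1+n; ↑ʳ-injective
        ; splitAt-↑ˡ; splitAt-↑ʳ; splitAt⁻¹-↑ˡ; join-splitAt)
open import Data.Bool using (Bool; true; false; T; _∧_)
open import Data.Bool.Properties using (¬-not)
open import Data.Product using (∃; _×_; _,_; proj₁; proj₂)
open import Data.Sum using (_⊎_; inj₁; inj₂; [_,_]′)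
open import Data.Integer using (+≤+)
open import Data.Rational using (ℚ; _*_; 0ℚ; 1ℚ; *≤*) renaming (_≤_ to _≤ℚ_)
import Data.Rational.Properties as ℚ
open import Function using (_∘_; const; Injective; mk⇔)
open import Relation.Nullary using (Dec; yes; no; does; contradiction; ¬?; _×-dec_)
open import Relation.Nullary.Decidable
  using (dec-true; dec-false; does-⇔; isYes≗does; toWitness; decidable-stable)
open import Relation.Binary.PropositionalEquality

count-cong : ∀ {n} {p q : Fin n → Bool} → (∀ i → p i ≡ q i) → count p ≡ count q
count-cong {zero}  p≗q = refl
count-cong {suc n} p≗q = cong₂ _+_ (cong b2n (p≗q zero)) (count-cong (p≗q ∘ suc))

count-false : ∀ {n} {p : Fin n → Bool} → (∀ i → p i ≡ false) → count p ≡ 0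
count-false {zero}      p≡false = refl
count-false {suc n} {p} p≡false rewrite p≡false zero = count-false (p≡false ∘ suc)

count-true≢0 : ∀ {n} {p : Fin n → Bool} (x : Fin n) → p x ≡ true → count p ≢ 0
count-true≢0         zero    px≡true rewrite px≡true = λ ()
count-true≢0 {p = p} (suc x) px≡true =
  count-true≢0 x px≡true ∘ m+n≡0⇒n≡0 (b2n (p zero))

count-unique : ∀ {n} {p : Fin n → Bool} (x : Fin n) → p x ≡ true →
               (∀ y → p y ≡ true → y ≡ x) → count p ≡ 1
count-unique zero px≡true unique rewrite px≡true =
  cong suc (count-false (λ i → ¬-not (λ pi≡true → 0≢1+n (sym (unique (suc i) pi≡true)))))
count-unique (suc x) px≡true unique rewrite ¬-not (λ p0≡true → 0≢1+n (unique zero p0≡true)) =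
  count-unique x px≡true (λ y py≡true → suc-injective (unique (suc y) py≡true))

ℕ→ℚ-injective : ∀ m n → ℕ→ℚ m ≡ ℕ→ℚ n → m ≡ n
ℕ→ℚ-injective m n eq =
  trans (sym (*-identityʳ m)) (trans (ℚ.normalize-injective-≃ m n 1 1 eq) (*-identityʳ n))

module _ (G : Graph) {k : ℕ} (c : Vertex G → Fin k) where

  EdgeMonochromatic : Set
  EdgeMonochromatic = ∀ u v → adj G u v ≡ true → c u ≡ c v

  eColor-none : ∀ v i → (∀ u → adj G v u ≡ true → c u ≢ i) → eColor G c v i ≡ 0
  eColor-none v i noNeighbour = count-false edgeToI≡false
    where
    edgeToI≡false : ∀ u → (adj G v u ∧ does (c u ≟ i)) ≡ false
    edgeToI≡false u with adj G v u in vu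
    ... | false = refl
    ... | true  = dec-false (c u ≟ i) (noNeighbour u vu)

  eColor-all : ∀ v i → (∀ u → adj G v u ≡ true → c u ≡ i) → eColor G c v i ≡ deg G v
  eColor-all v i allNeighbours = count-cong edgeToI≡edge
    where
    edgeToI≡edge : ∀ u → (adj G v u ∧ does (c u ≟ i)) ≡ adj G v u
    edgeToI≡edge u with adj G v u in vu
    ... | false = refl
    ... | true  = dec-true (c u ≟ i) (allNeighbours u vu)

  eColor-neighbour≢0 : ∀ {v u} → adj G v u ≡ true → eColor G c v (c u) ≢ 0
  eColor-neighbour≢0 {u = u} vu = count-true≢0 u (cong₂ _∧_ vu (dec-true (c u ≟ c u) refl))

  edgeMonochromatic⇒FAT : (∀ i → ∃ λ v → c v ≡ i) → EdgeMonochromatic → IsFATColoring G k c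
  edgeMonochromatic⇒FAT surjective mono =
    surjective , 0ℚ , 1ℚ , ℚ.≤-refl , 0≤1 , 0≤1 , ℚ.≤-refl , λ v i →
      (λ cv≢i → trans (cong ℕ→ℚ (eColor-none v i (λ u vu cu≡i → cv≢i (trans (mono v u vu) cu≡i))))
                      (sym (ℚ.*-zeroˡ (ℕ→ℚ (deg G v))))) ,
      (λ cv≡i → trans (cong ℕ→ℚ (eColor-all v i (λ u vu → trans (sym (mono v u vu)) cv≡i)))
                      (sym (ℚ.*-identityˡ (ℕ→ℚ (deg G v)))))
    where
    0≤1 : 0ℚ ≤ℚ 1ℚ
    0≤1 = *≤* (+≤+ z≤n)

coveredByTwo⇒≤2 : ∀ {j} (x y : Fin j) → (∀ i → x ≡ i ⊎ y ≡ i) → j ≤ 2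
coveredByTwo⇒≤2 x y cover = injective⇒≤ {f = side ∘ cover} side-injective
  where
  side : ∀ {i} → x ≡ i ⊎ y ≡ i → Fin 2
  side = [ const zero , const (suc zero) ]′

  side-injective : Injective _≡_ _≡_ (side ∘ cover)
  side-injective {i} {i′} = sameSide (cover i) (cover i′)
    where
    sameSide : (p : x ≡ i ⊎ y ≡ i) (q : x ≡ i′ ⊎ y ≡ i′) → side p ≡ side q → i ≡ i′
    sameSide (inj₁ x≡i) (inj₁ x≡i′) _ = trans (sym x≡i) x≡i′
    sameSide (inj₂ y≡i) (inj₂ y≡i′) _ = trans (sym y≡i) y≡i′
    sameSide (inj₁ _)   (inj₂ _)    ()
    sameSide (inj₂ _)   (inj₁ _)    ()

thirdColour : ∀ {j} (x y : Fin j) → j ≤ 2 ⊎ ∃ λ i → x ≢ i × y ≢ i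
thirdColour x y with any? (λ i → ¬? (x ≟ i) ×-dec ¬? (y ≟ i))
... | yes third = inj₂ third
... | no  none  = inj₁ (coveredByTwo⇒≤2 x y cover)
  where
  cover : ∀ i → x ≡ i ⊎ y ≡ i
  cover i with x ≟ i | y ≟ i
  ... | yes x≡i | _       = inj₁ x≡i
  ... | no  _   | yes y≡i = inj₂ y≡i
  ... | no  x≢i | no  y≢i = contradiction (i , x≢i , y≢i) none

module FATColoring {G : Graph} {k : ℕ} {c : Vertex G → Fin k} (fat : IsFATColoring G k c) where

  α : ℚ
  α = proj₁ (proj₂ fat)

  offClass : ∀ v i → c v ≢ i → ℕ→ℚ (eColor G c v i) ≡ α * ℕ→ℚ (deg G v)
  offClass v i = let (_ , _ , _ , _ , _ , _ , _ , conditions) = fat in proj₁ (conditions v i)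

  α≡0⇒edgeMonochromatic : α ≡ 0ℚ → EdgeMonochromatic G c
  α≡0⇒edgeMonochromatic α≡0 u v uv with c u ≟ c v
  ... | yes cu≡cv = cu≡cv
  ... | no  cu≢cv =
    contradiction (ℕ→ℚ-injective _ 0 noNeighbourColouredCv) (eColor-neighbour≢0 G c uv)
    where
    noNeighbourColouredCv : ℕ→ℚ (eColor G c u (c v)) ≡ 0ℚ
    noNeighbourColouredCv = begin
      ℕ→ℚ (eColor G c u (c v)) ≡⟨ offClass u (c v) cu≢cv ⟩
      α * ℕ→ℚ (deg G u)        ≡⟨ cong (_* ℕ→ℚ (deg G u)) α≡0 ⟩
      0ℚ * ℕ→ℚ (deg G u)       ≡⟨ ℚ.*-zeroˡ (ℕ→ℚ (deg G u)) ⟩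
      0ℚ                        ∎
      where open ≡-Reasoning

  pendant⇒α≡0 : ∀ a b → adj G a b ≡ true → (∀ u → adj G a u ≡ true → u ≡ b) →
                ∀ i → c a ≢ i → c b ≢ i → α ≡ 0ℚ
  pendant⇒α≡0 a b ab onlyB i ca≢i cb≢i = begin
    α                         ≡⟨ ℚ.*-identityʳ α ⟨
    α * ℕ→ℚ 1                 ≡⟨ cong (λ d → α * ℕ→ℚ d) (count-unique b ab onlyB) ⟨
    α * ℕ→ℚ (deg G a)         ≡⟨ offClass a i ca≢i ⟨
    ℕ→ℚ (eColor G c a i)      ≡⟨ cong ℕ→ℚ (eColor-none G c a i onlyNeighbourNotI) ⟩
    0ℚ                        ∎
    where
    open ≡-Reasoning
    onlyNeighbourNotI : ∀ u → adj G a u ≡ true → c u ≢ i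
    onlyNeighbourNotI u au rewrite onlyB u au = cb≢i

  pendant⇒≤2⊎edgeMonochromatic : ∀ a b → adj G a b ≡ true → (∀ u → adj G a u ≡ true → u ≡ b) →
                                 k ≤ 2 ⊎ EdgeMonochromatic G c
  pendant⇒≤2⊎edgeMonochromatic a b ab onlyB with thirdColour (c a) (c b)
  ... | inj₁ k≤2                = inj₁ k≤2
  ... | inj₂ (i , ca≢i , cb≢i) = inj₂ (α≡0⇒edgeMonochromatic (pendant⇒α≡0 a b ab onlyB i ca≢i cb≢i))

constantOnFibres⇒≤ : ∀ {A : Set} {j m} (c : A → Fin j) (f : A → Fin m) →
                     (∀ i → ∃ λ v → c v ≡ i) → (∀ u v → f u ≡ f v → c u ≡ c v) → j ≤ m
constantOnFibres⇒≤ c f surjective constant =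
  injective⇒≤ {f = f ∘ proj₁ ∘ surjective} λ {i} {i′} same →
    trans (sym (proj₂ (surjective i))) (trans (constant _ _ same) (proj₂ (surjective i′)))

clique⇒≤colours : ∀ {G : Graph} {s j} (clique : Fin s → Vertex G) →
                  (∀ x y → x ≢ y → adj G (clique x) (clique y) ≡ true) →
                  HasProperColoring G j → s ≤ j
clique⇒≤colours clique adjacent (c , proper) =
  injective⇒≤ {f = c ∘ clique} λ {x} {y} same →
    decidable-stable (x ≟ y) (λ x≢y → proper _ _ (adjacent x y x≢y) same)

module UnionOfCliques {n m : ℕ} (nonempty : 0 < n) (component : Fin n → Fin m) where

  Adjacent : Fin n → Fin n → Set
  Adjacent u v = component u ≡ component v × u ≢ v

  adjacent? : ∀ u v → Dec (Adjacent u v)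
  adjacent? u v = (component u ≟ component v) ×-dec ¬? (u ≟ v)

  adjacent : Fin n → Fin n → Bool
  adjacent u v = does (adjacent? u v)

  graph : Graph
  graph = record
    { order    = n
    ; nonempty = nonempty
    ; adj      = adjacent
    ; adj-sym  = λ u v → does-⇔ (mk⇔ flip flip) (adjacent? u v) (adjacent? v u)
    ; irrefl   = λ v → dec-false (adjacent? v v) (λ (_ , v≢v) → v≢v refl)
    }
    where
    flip : ∀ {u v} → Adjacent u v → Adjacent v u
    flip (same , u≢v) = sym same , u≢v ∘ sym

  adjacent⇒Adjacent : ∀ u v → adjacent u v ≡ true → Adjacent u v
  adjacent⇒Adjacent u v uv =
    toWitness (subst T (sym (trans (isYes≗does (adjacent? u v)) uv)) _)

  Adjacent⇒adjacent : ∀ u v → Adjacent u v → adjacent u v ≡ true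
  Adjacent⇒adjacent u v = dec-true (adjacent? u v)

  reachable⇒sameComponent : ∀ {u v} → Reachable graph u v → component u ≡ component v
  reachable⇒sameComponent here          = refl
  reachable⇒sameComponent (step uw wv) =
    trans (proj₁ (adjacent⇒Adjacent _ _ uw)) (reachable⇒sameComponent wv)

  edgeMonochromatic⇒constantOnComponents : ∀ {k} {c : Fin n → Fin k} → EdgeMonochromatic graph c →
                                           ∀ u v → component u ≡ component v → c u ≡ c v
  edgeMonochromatic⇒constantOnComponents {c = c} mono u v same with u ≟ v
  ... | yes u≡v = cong c u≡v
  ... | no  u≢v = mono u v (Adjacent⇒adjacent u v (same , u≢v))

  injectiveOnComponents⇒proper : ∀ {k} {c : Fin n → Fin k} →
                                 (∀ u v → component u ≡ component v → c u ≡ c v → u ≡ v) →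
                                 IsProperColoring graph k c
  injectiveOnComponents⇒proper injective u v uv =
    let (same , u≢v) = adjacent⇒Adjacent u v uv in u≢v ∘ injective u v same

  componentColouring : (∀ i → ∃ λ v → component v ≡ i) → IsFATColoring graph m component
  componentColouring surjective =
    edgeMonochromatic⇒FAT graph component surjective (λ u v → proj₁ ∘ adjacent⇒Adjacent u v)

  pendant⇒FATColours≤ : ∀ a b {j} → adjacent a b ≡ true → (∀ u → adjacent a u ≡ true → u ≡ b) →
                        2 ≤ m → HasFATColoring graph j → j ≤ m
  pendant⇒FATColours≤ a b ab onlyB 2≤m (c , fat)
    with FATColoring.pendant⇒≤2⊎edgeMonochromatic {G = graph} fat a b ab onlyB
  ... | inj₁ j≤2 = ≤-trans j≤2 2≤m
  ... | inj₂ mono =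
    constantOnFibres⇒≤ c component (proj₁ fat) (edgeMonochromatic⇒constantOnComponents {c = c} mono)

module Witness (m k : ℕ) where

  L₁ L₂ : ℕ
  L₁ = suc (suc m)
  L₂ = suc (suc k)

  -- The first L₁ vertices are the K₂ on 0, 1 followed by m isolated
  -- vertices; the last L₂ vertices form the clique, which is component 0.
  merge₀₁ : Fin L₁ → Fin (suc m)
  merge₀₁ zero    = zero
  merge₀₁ (suc t) = t

  componentOf : Fin L₁ ⊎ Fin L₂ → Fin L₁
  componentOf (inj₁ t) = suc (merge₀₁ t)
  componentOf (inj₂ _) = zero

  colourOf : Fin L₁ ⊎ Fin L₂ → Fin L₂
  colourOf (inj₁ zero)    = zero
  colourOf (inj₁ (suc _)) = suc zero
  colourOf (inj₂ i)       = i

  colourOf-injectiveOnComponents : ∀ x y → componentOf x ≡ componentOf y →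
                                   colourOf x ≡ colourOf y → x ≡ y
  colourOf-injectiveOnComponents (inj₁ zero)    (inj₁ zero)    _    _    = refl
  colourOf-injectiveOnComponents (inj₁ (suc _)) (inj₁ (suc _)) refl _    = refl
  colourOf-injectiveOnComponents (inj₂ _)       (inj₂ _)       _    refl = refl
  colourOf-injectiveOnComponents (inj₁ zero)    (inj₁ (suc _)) _    ()
  colourOf-injectiveOnComponents (inj₁ (suc _)) (inj₁ zero)    _    ()
  colourOf-injectiveOnComponents (inj₁ _)       (inj₂ _)       ()   _
  colourOf-injectiveOnComponents (inj₂ _)       (inj₁ _)       ()   _

  componentOf≡1 : ∀ x → componentOf x ≡ suc zero → x ≡ inj₁ zero ⊎ x ≡ inj₁ (suc zero)
  componentOf≡1 (inj₁ zero)          _ = inj₁ refl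
  componentOf≡1 (inj₁ (suc zero))    _ = inj₂ refl
  componentOf≡1 (inj₁ (suc (suc _))) ()
  componentOf≡1 (inj₂ _)             ()

  component : Fin (L₁ + L₂) → Fin L₁
  component = componentOf ∘ splitAt L₁

  open UnionOfCliques (s≤s z≤n) component public

  splitAt-injective : ∀ {u v} → splitAt L₁ {L₂} u ≡ splitAt L₁ v → u ≡ v
  splitAt-injective {u} {v} eq =
    trans (sym (join-splitAt L₁ L₂ u)) (trans (cong (join L₁ L₂) eq) (join-splitAt L₁ L₂ v))

  component-clique : ∀ i → component (L₁ ↑ʳ i) ≡ zero
  component-clique i = cong componentOf (splitAt-↑ʳ L₁ L₂ i)

  component-surjective : ∀ i → ∃ λ v → component v ≡ i
  component-surjective zero    = L₁ ↑ʳ zero , component-clique zero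
  component-surjective (suc i) = suc i ↑ˡ L₂ , cong componentOf (splitAt-↑ˡ L₁ (suc i) L₂)

  pendantEdge : adjacent zero (suc zero) ≡ true
  pendantEdge = Adjacent⇒adjacent zero (suc zero) (refl , λ ())

  onlyNeighbour : ∀ u → adjacent zero u ≡ true → u ≡ suc zero
  onlyNeighbour u 0u with adjacent⇒Adjacent zero u 0u
  ... | same , 0≢u with componentOf≡1 (splitAt L₁ u) (sym same)
  ...   | inj₁ u↦0 = contradiction (splitAt⁻¹-↑ˡ u↦0) 0≢u
  ...   | inj₂ u↦1 = sym (splitAt⁻¹-↑ˡ u↦1)

  disconnected : Disconnected graph
  disconnected = zero , L₁ ↑ʳ zero , λ path →
    0≢1+n (sym (trans (reachable⇒sameComponent path) (component-clique zero)))

  fatChromaticNumber : IsFATChromaticNumber graph L₁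
  fatChromaticNumber =
    (component , componentColouring component-surjective) ,
    λ j → pendant⇒FATColours≤ zero (suc zero) pendantEdge onlyNeighbour (s≤s (s≤s z≤n))

  chromaticNumber : IsChromaticNumber graph L₂
  chromaticNumber =
    (colourOf ∘ splitAt L₁ ,
     injectiveOnComponents⇒proper λ u v same sameColour →
       splitAt-injective (colourOf-injectiveOnComponents _ _ same sameColour)) ,
    λ j → clique⇒≤colours {G = graph} (L₁ ↑ʳ_) cliqueEdge
    where
    cliqueEdge : ∀ x y → x ≢ y → adjacent (L₁ ↑ʳ x) (L₁ ↑ʳ y) ≡ true
    cliqueEdge x y x≢y = Adjacent⇒adjacent (L₁ ↑ʳ x) (L₁ ↑ʳ y)
      (trans (component-clique x) (sym (component-clique y)) , x≢y ∘ ↑ʳ-injective L₁ x y)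

theorem2p2 : (L₁ L₂ : ℕ) → 1 < L₁ → L₁ < L₂ →
    ∃ λ (G : Graph) → Disconnected G × IsFATChromaticNumber G L₁ × IsChromaticNumber G L₂
theorem2p2 (suc (suc m)) (suc (suc (suc k))) (s≤s (s≤s z≤n)) (s≤s (s≤s (s≤s _))) =
  graph , disconnected , fatChromaticNumber , chromaticNumber
  where open Witness m (suc k)
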